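{- Let $F$ be a forest and $G$ be a graph both on $n$ vertices, and let $c(F)$ be the number of components of $F$ that contain at least one edge and $\ell(F)$ the number of vertices of $F$ with degree 1. If \[ 3\Delta(G)+\ell(F)-2c(F)< n, \] then $F$ and $G$ pack.
   Context: For two graphs $G$ and $H$ with $|V(G)|\geq |V(H)|$, $G$ and $H$ pack if there is an injective function $f:V(H)\to V(G)$ such that for any $xy\in E(H)$, $f(x)f(y)\notin E(G)$. $\Delta(G)$ denotes the maximum degree of $G$. -}

module Defs where

open import Data.Nat using (ℕ; zero; suc; _+_; _⊔_)
open import Data.Fin using (Fin)
open import Data.Bool using (Bool; true; false)
open import Data.List using (List; []; _∷_; length; filter; map; foldr)
open import Data.List.Base using (allFin)
open import Data.Product using (Σ; _×_; ∃; ∃-syntax)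
open import Data.Nat.Properties using (_≟_)
open import Data.Bool.Properties renaming (_≟_ to _≟ᵇ_)
open import Data.List.Relation.Unary.AllPairs using (AllPairs)
open import Relation.Nullary using (¬_)
open import Relation.Binary.PropositionalEquality using (_≡_; _≢_)
open import Function.Definitions using (Injective)

record Graph (n : ℕ) : Set where
  field
    adj   : Fin n → Fin n → Bool
    sym   : ∀ x y → adj x y ≡ adj y x
    irrefl : ∀ x → adj x x ≡ false
open Graph public

deg : ∀ {n} → Graph n → Fin n → ℕ
deg G v = length (filter (λ u → adj G v u ≟ᵇ true) (allFin _))

Δ : ∀ {n} → Graph n → ℕ
Δ G = foldr _⊔_ 0 (map (deg G) (allFin _))

leaves : ∀ {n} → Graph n → ℕ
leaves F = length (filter (λ v → deg F v ≟ 1) (allFin _))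

data Path {n} (G : Graph n) : List (Fin n) → Set where
  single : ∀ v → Path G (v ∷ [])
  step   : ∀ {u v vs} → adj G u v ≡ true → Path G (v ∷ vs) → Path G (u ∷ v ∷ vs)

record Cycle {n} (G : Graph n) : Set where
  field
    first   : Fin n
    middle  : Fin n
    rest    : List (Fin n)
    last    : Fin n
    path    : Path G (first ∷ middle ∷ Data.List._++_ rest (last ∷ []))
    closing : adj G last first ≡ true
    distinct : AllPairs _≢_ (first ∷ middle ∷ Data.List._++_ rest (last ∷ []))

IsForest : ∀ {n} → Graph n → Set
IsForest G = ¬ Cycle G

data Connected {n} (G : Graph n) : Fin n → Fin n → Set where
  here  : ∀ v → Connected G v v
  there : ∀ {u w v} → adj G u w ≡ true → Connected G w v → Connected G u v

NonIsolated : ∀ {n} → Graph n → Fin n → Set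
NonIsolated G v = ∃[ u ] adj G v u ≡ true

-- G has exactly c components containing at least one edge:
-- there are c representatives, each non-isolated, pairwise in different
-- components, and every non-isolated vertex is in the component of one of them.
-- (A component contains an edge iff it contains a non-isolated vertex.)
NontrivialComponents : ∀ {n} → Graph n → ℕ → Set
NontrivialComponents {n} G c =
  Σ (Fin c → Fin n) λ rep →
      (∀ i → NonIsolated G (rep i))
    × (∀ i j → Connected G (rep i) (rep j) → i ≡ j)
    × (∀ v → NonIsolated G v → ∃[ i ] Connected G v (rep i))

Pack : ∀ {n} → Graph n → Graph n → Set
Pack {n} G H =
  Σ (Fin n → Fin n) λ f → Injective _≡_ _≡_ f
    × (∀ x y → adj H x y ≡ true → adj G (f x) (f y) ≡ false)

-- Write K(F) = Σ_v (deg v ∸ 2).  Deleting a leaf shows, by induction, that every forest has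
-- K(F) + 2 c(F) ≤ ℓ(F), so the hypothesis yields 3 Δ(G) + K(F) < n, and it suffices to pack
-- under this bound.  Again delete a leaf x with neighbour y and pack F − x by f.  If f x f y is
-- an edge of G, exchange x with a vertex z such that f z is not adjacent to f y, z ≠ y, and no
-- neighbour w of z in F − x has f w adjacent to f x.  The excluded vertices number at most
-- Δ + 1 + Σ_{f w ∈ N_G(f x)} deg_{F−x} w ≤ Δ + Σ_{f w ∈ N_G(f x)} deg_F w ≤ 3 Δ + K(F) < n,
-- the middle step because y is among these w and lost its neighbour x.
module Submission where

open import Data.Bool using (Bool; true; false; _∧_; _∨_; not)
open import Data.Bool.Properties
  using (∧-comm; ∧-identityʳ; ∧-zeroʳ; ¬-not; ∨-conicalˡ; ∨-conicalʳ) renaming (_≟_ to _≟ᵇ_)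
open import Data.Fin using (Fin; zero; suc; punchIn; punchOut)
open import Data.Fin.Permutation.Components using (transpose; transpose-inverse)
open import Data.Fin.Properties
  using (suc-injective; 0≢1+n; any?; injective⇒≤; punchIn-injective; punchInᵢ≢i; punchIn-punchOut)
  renaming (_≟_ to _≟ᶠ_)
open import Data.List using (List; []; _∷_; _++_; length; lookup; filter; tabulate; foldr)
open import Data.List.Membership.Propositional using (_∈_)
open import Data.List.Membership.Propositional.Properties using (∈-∃++; ∈-map⁺; ∈-allFin; ∈-lookup)
import Data.List.Membership.DecPropositional as DecMembership
open import Data.List.Relation.Unary.Any using (here; there)
open import Data.List.Relation.Unary.All as All using (All; []; _∷_)
open import Data.List.Relation.Unary.All.Properties using (¬Any⇒All¬; ++⁻ˡ; ++⁻ʳ; ++⁺)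
open import Data.List.Relation.Unary.AllPairs using (AllPairs; []; _∷_)
open import Data.Nat using (ℕ; zero; suc; _+_; _*_; _<_; _≤_; _∸_; _⊔_; z≤n; s≤s)
import Data.Nat as ℕ
open import Data.Nat.Induction using (<-wellFounded)
open import Data.Nat.Properties hiding (_≟_; suc-injective; 0≢1+n)
open import Algebra.Properties.CommutativeSemigroup +-commutativeSemigroup using (xy∙z≈zy∙x; xy∙z≈xz∙y)
open import Algebra.Properties.CommutativeMonoid.Sum +-0-commutativeMonoid
  using (sum; sum-syntax; sum-cong-≗; ∑-comm; ∑-distrib-+; sum-replicate-zero)
open import Data.Nat.Tactic.RingSolver using (solve-∀)
open import Data.Product using (Σ; _×_; _,_; ∃₂; ∃-syntax; proj₁; proj₂)
open import Data.Sum using (_⊎_; inj₁; inj₂)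
open import Function using (_∘_; id)
open import Function.Definitions using (Injective)
open import Induction.WellFounded using (Acc; acc)
open import Relation.Binary.PropositionalEquality
open import Relation.Nullary using (¬_; Dec; yes; no; does; contradiction)
open import Relation.Nullary.Decidable using (dec-true; dec-false; ¬?; _×-dec_; decidable-stable)

open import Defs hiding (sym)

bit : Bool → ℕ
bit true  = 1
bit false = 0

count : ∀ {n} → (Fin n → Bool) → ℕ
count p = sum (bit ∘ p)

sum-mono-≤ : ∀ {n} {h k : Fin n → ℕ} → (∀ i → h i ≤ k i) → sum h ≤ sum k
sum-mono-≤ {zero}  h≤k = z≤n
sum-mono-≤ {suc n} h≤k = +-mono-≤ (h≤k zero) (sum-mono-≤ (h≤k ∘ suc))

sum-mono-< : ∀ {n} {h k : Fin n → ℕ} a → (∀ i → h i ≤ k i) → h a < k a → sum h < sum k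
sum-mono-< zero    h≤k lt = +-mono-<-≤ lt (sum-mono-≤ (h≤k ∘ suc))
sum-mono-< (suc a) h≤k lt = +-mono-≤-< (h≤k zero) (sum-mono-< a (h≤k ∘ suc) lt)

term≤sum : ∀ {n} (h : Fin n → ℕ) a → h a ≤ sum h
term≤sum h zero    = m≤m+n _ _
term≤sum h (suc a) = ≤-trans (term≤sum (h ∘ suc) a) (m≤n+m _ _)

sum-zero : ∀ {n} {h : Fin n → ℕ} → (∀ i → h i ≡ 0) → sum h ≡ 0
sum-zero {n} h≗0 = trans (sum-cong-≗ h≗0) (sum-replicate-zero n)

sum-exchange : ∀ {n} {h k : Fin n → ℕ} a → (∀ i → i ≢ a → h i ≡ k i) → sum h + k a ≡ sum k + h a
sum-exchange {suc n} {h} {k} zero h≗k = begin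
  h zero + sum (h ∘ suc) + k zero  ≡⟨ cong (λ s → h zero + s + k zero) (sum-cong-≗ λ i → h≗k (suc i) λ ()) ⟩
  h zero + sum (k ∘ suc) + k zero  ≡⟨ xy∙z≈zy∙x (h zero) _ (k zero) ⟩
  k zero + sum (k ∘ suc) + h zero  ∎
  where open ≡-Reasoning
sum-exchange {suc n} {h} {k} (suc a) h≗k = begin
  h zero + sum (h ∘ suc) + k (suc a)    ≡⟨ +-assoc (h zero) _ _ ⟩
  h zero + (sum (h ∘ suc) + k (suc a))  ≡⟨ cong₂ _+_ (h≗k zero λ ()) (sum-exchange a λ i i≢a → h≗k (suc i) (i≢a ∘ suc-injective)) ⟩
  k zero + (sum (k ∘ suc) + h (suc a))  ≡⟨ +-assoc (k zero) _ _ ⟨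
  k zero + sum (k ∘ suc) + h (suc a)    ∎
  where open ≡-Reasoning

sum-exchange₂ : ∀ {n} {h k : Fin n → ℕ} {a b} → a ≢ b → (∀ i → i ≢ a → i ≢ b → h i ≡ k i) →
                sum h + (k a + k b) ≡ sum k + (h a + h b)
sum-exchange₂ {h = h} {k} {a} {b} a≢b h≗k = begin
  sum h + (k a + k b)  ≡⟨ cong (λ t → sum h + (t + k b)) m-at-a ⟨
  sum h + (m a + k b)  ≡⟨ +-assoc (sum h) (m a) (k b) ⟨
  sum h + m a + k b    ≡⟨ cong (_+ k b) (sum-exchange a h≗m) ⟩
  sum m + h a + k b    ≡⟨ xy∙z≈xz∙y (sum m) (h a) (k b) ⟩
  sum m + k b + h a    ≡⟨ cong (_+ h a) (sum-exchange b m≗k) ⟩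
  sum k + m b + h a    ≡⟨ cong (λ t → sum k + t + h a) (sym (h≗m b (≢-sym a≢b))) ⟩
  sum k + h b + h a    ≡⟨ +-assoc (sum k) (h b) (h a) ⟩
  sum k + (h b + h a)  ≡⟨ cong (sum k +_) (+-comm (h b) (h a)) ⟩
  sum k + (h a + h b)  ∎
  where
  open ≡-Reasoning
  m : _ → ℕ
  m i with i ≟ᶠ a
  ... | yes _ = k i
  ... | no _  = h i
  h≗m : ∀ i → i ≢ a → h i ≡ m i
  h≗m i i≢a with i ≟ᶠ a
  ... | yes i≡a = contradiction i≡a i≢a
  ... | no _    = refl
  m≗k : ∀ i → i ≢ b → m i ≡ k i
  m≗k i i≢b with i ≟ᶠ a
  ... | yes _   = refl
  ... | no i≢a  = h≗k i i≢a i≢b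
  m-at-a : m a ≡ k a
  m-at-a with a ≟ᶠ a
  ... | yes _  = refl
  ... | no a≢a = contradiction refl a≢a

count-mono : ∀ {n} {p q : Fin n → Bool} → (∀ i → p i ≡ true → q i ≡ true) → count p ≤ count q
count-mono {p = p} p⇒q = sum-mono-≤ λ i → bit-mono (p i) (p⇒q i)
  where
  bit-mono : ∀ a {b} → (a ≡ true → b ≡ true) → bit a ≤ bit b
  bit-mono false _   = z≤n
  bit-mono true  a⇒b = ≤-reflexive (cong bit (sym (a⇒b refl)))

count-∨ : ∀ {n} (p q : Fin n → Bool) → count (λ i → p i ∨ q i) ≤ count p + count q
count-∨ p q = ≤-trans (sum-mono-≤ λ i → bit-∨ (p i) (q i)) (≤-reflexive (∑-distrib-+ (bit ∘ p) (bit ∘ q)))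
  where
  bit-∨ : ∀ a b → bit (a ∨ b) ≤ bit a + bit b
  bit-∨ true  b = s≤s z≤n
  bit-∨ false b = ≤-refl

count-false : ∀ {n} {p : Fin n → Bool} → (∀ i → p i ≡ false) → count p ≡ 0
count-false p≗false = sum-zero (cong bit ∘ p≗false)

count-true : ∀ {n} {p : Fin n → Bool} a → p a ≡ true → 0 < count p
count-true {p = p} a pa = ≤-trans (≤-reflexive (cong bit (sym pa))) (term≤sum (bit ∘ p) a)

count<n⇒∃false : ∀ {n} (p : Fin n → Bool) → count p < n → ∃[ i ] p i ≡ false
count<n⇒∃false {suc n} p lt with p zero in p0
... | false = zero , p0
... | true  with i , pi ← count<n⇒∃false (p ∘ suc) (≤-pred lt) = suc i , pi

count-≟ : ∀ {n} (a : Fin n) → count (λ i → does (i ≟ᶠ a)) ≡ 1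
count-≟ {n} a = begin
  count (λ i → does (i ≟ᶠ a))              ≡⟨ +-identityʳ _ ⟨
  count (λ i → does (i ≟ᶠ a)) + 0          ≡⟨ sum-exchange a (λ i i≢a → cong bit (dec-false (i ≟ᶠ a) i≢a)) ⟩
  sum {n} (λ _ → 0) + bit (does (a ≟ᶠ a))  ≡⟨ cong₂ _+_ (sum-zero {n} λ _ → refl) (cong bit (dec-true (a ≟ᶠ a) refl)) ⟩
  1                                        ∎
  where open ≡-Reasoning

without : ∀ {n} → Fin n → (Fin n → Bool) → Fin n → Bool
without a p i = p i ∧ not (does (i ≟ᶠ a))

count-without : ∀ {n} (a : Fin n) (p : Fin n → Bool) → count p ≡ count (without a p) + bit (p a)
count-without a p = begin
  count p                          ≡⟨ +-identityʳ _ ⟨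
  count p + bit false              ≡⟨ cong (λ b → count p + bit b) without-self ⟨
  count p + bit (without a p a)    ≡⟨ sum-exchange a agree ⟩
  count (without a p) + bit (p a)  ∎
  where
  open ≡-Reasoning
  without-self : without a p a ≡ false
  without-self rewrite dec-true (a ≟ᶠ a) refl = ∧-zeroʳ (p a)
  agree : ∀ i → i ≢ a → bit (p i) ≡ bit (without a p i)
  agree i i≢a rewrite dec-false (i ≟ᶠ a) i≢a = cong bit (sym (∧-identityʳ (p i)))

count-∘-injective : ∀ {m n} (p : Fin n → Bool) (f : Fin m → Fin n) → Injective _≡_ _≡_ f →
                    count (p ∘ f) ≤ count p
count-∘-injective {zero}  p f f-inj = z≤n
count-∘-injective {suc m} p f f-inj = begin
  bit (p a) + count (p ∘ f ∘ suc)            ≡⟨ cong (bit (p a) +_) (sum-cong-≗ (cong bit ∘ away)) ⟩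
  bit (p a) + count (without a p ∘ f ∘ suc)  ≤⟨ +-monoʳ-≤ (bit (p a)) (count-∘-injective (without a p) (f ∘ suc) (suc-injective ∘ f-inj)) ⟩
  bit (p a) + count (without a p)            ≡⟨ +-comm (bit (p a)) _ ⟩
  count (without a p) + bit (p a)            ≡⟨ count-without a p ⟨
  count p                                    ∎
  where
  open ≤-Reasoning
  a = f zero
  away : ∀ i → p (f (suc i)) ≡ without a p (f (suc i))
  away i rewrite dec-false (f (suc i) ≟ᶠ a) (λ e → 0≢1+n (sym (f-inj e))) = sym (∧-identityʳ _)

union-bound : ∀ {m n} (r : Fin m → Fin n → Bool) →
              count (λ z → does (any? λ w → r z w ≟ᵇ true)) ≤ ∑[ w < n ] count (λ z → r z w)
union-bound {m} {n} r = begin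
  count (λ z → does (any? λ w → r z w ≟ᵇ true))  ≤⟨ sum-mono-≤ (λ z → bit-any (r z)) ⟩
  ∑[ z < m ] ∑[ w < n ] bit (r z w)              ≡⟨ ∑-comm (λ z w → bit (r z w)) ⟩
  ∑[ w < n ] ∑[ z < m ] bit (r z w)              ∎
  where
  open ≤-Reasoning
  bit-any : (q : Fin n → Bool) → bit (does (any? λ w → q w ≟ᵇ true)) ≤ count q
  bit-any q with any? (λ w → q w ≟ᵇ true)
  ... | yes (w , qw) = count-true w qw
  ... | no _         = z≤n

adj-sym : ∀ {n} (G : Graph n) {u v} → adj G u v ≡ true → adj G v u ≡ true
adj-sym G {u} {v} uv = trans (Graph.sym G v u) uv

nonadj-sym : ∀ {n} (G : Graph n) {u v} → adj G u v ≡ false → adj G v u ≡ false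
nonadj-sym G {u} {v} uv = trans (Graph.sym G v u) uv

adj⇒≢ : ∀ {n} (G : Graph n) {u v} → adj G u v ≡ true → u ≢ v
adj⇒≢ G {u} uv refl with () ← trans (sym uv) (Graph.irrefl G u)

degree : ∀ {n} → Graph n → Fin n → ℕ
degree G v = count (adj G v)

length-filter-tabulate : ∀ {A : Set} {P : A → Set} (P? : ∀ a → Dec (P a)) {n} (g : Fin n → A) →
                         length (filter P? (tabulate g)) ≡ count (λ i → does (P? (g i)))
length-filter-tabulate P? {zero}  g = refl
length-filter-tabulate P? {suc n} g with does (P? (g zero))
... | true  = cong suc (length-filter-tabulate P? (g ∘ suc))
... | false = length-filter-tabulate P? (g ∘ suc)

deg≡degree : ∀ {n} (G : Graph n) v → deg G v ≡ degree G v
deg≡degree G v = trans (length-filter-tabulate (λ u → adj G v u ≟ᵇ true) id)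
                       (sum-cong-≗ λ u → cong bit (does-≟true (adj G v u)))
  where
  does-≟true : ∀ b → does (b ≟ᵇ true) ≡ b
  does-≟true true  = refl
  does-≟true false = refl

∈⇒≤foldr-⊔ : ∀ {m xs} → m ∈ xs → m ≤ foldr _⊔_ 0 xs
∈⇒≤foldr-⊔ (here refl)  = m≤m⊔n _ _
∈⇒≤foldr-⊔ (there m∈xs) = ≤-trans (∈⇒≤foldr-⊔ m∈xs) (m≤n⊔m _ _)

degree≤Δ : ∀ {n} (G : Graph n) v → degree G v ≤ Δ G
degree≤Δ G v = subst (_≤ Δ G) (deg≡degree G v) (∈⇒≤foldr-⊔ (∈-map⁺ (deg G) (∈-allFin v)))

record Leaf {n} (F : Graph n) (x y : Fin n) : Set where
  field
    edge   : adj F x y ≡ true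
    unique : ∀ w → adj F x w ≡ true → w ≡ y

lookup-injective : ∀ {A : Set} {xs : List A} → AllPairs _≢_ xs → Injective _≡_ _≡_ (lookup xs)
lookup-injective (x∉xs ∷ _)  {zero}  {zero}  _ = refl
lookup-injective (x∉xs ∷ _)  {zero}  {suc j} e = contradiction e (All.lookup x∉xs (∈-lookup j))
lookup-injective (x∉xs ∷ _)  {suc i} {zero}  e = contradiction (sym e) (All.lookup x∉xs (∈-lookup i))
lookup-injective (_ ∷ xs!)   {suc i} {suc j} e = cong suc (lookup-injective xs! e)

distinct-length≤ : ∀ {n} {xs : List (Fin n)} → AllPairs _≢_ xs → length xs ≤ n
distinct-length≤ xs! = injective⇒≤ (lookup-injective xs!)

module _ {A : Set} {w : A} {r₂ : List A} where

  All-prefix : ∀ {P : A → Set} r₁ → All P (r₁ ++ w ∷ r₂) → All P (r₁ ++ w ∷ [])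
  All-prefix r₁ ps = ++⁺ (++⁻ˡ r₁ ps) (All.head (++⁻ʳ r₁ ps) ∷ [])

  AllPairs-prefix : ∀ {R : A → A → Set} r₁ → AllPairs R (r₁ ++ w ∷ r₂) → AllPairs R (r₁ ++ w ∷ [])
  AllPairs-prefix []       (_ ∷ _)    = [] ∷ []
  AllPairs-prefix (_ ∷ r₁) (px ∷ pxs) = All-prefix r₁ px ∷ AllPairs-prefix r₁ pxs

Path-prefix : ∀ {n} {G : Graph n} {w r₂} a r₁ → Path G (a ∷ r₁ ++ w ∷ r₂) → Path G (a ∷ r₁ ++ w ∷ [])
Path-prefix a []       (step e _) = step e (single _)
Path-prefix a (b ∷ r₁) (step e p) = step e (Path-prefix b r₁ p)

module _ {n} {F : Graph n} (forest : IsForest F) where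
  open DecMembership (_≟ᶠ_ {n}) using (_∈?_)

  -- Grow a path of distinct vertices at its head v while v has a neighbour w other than the
  -- next vertex u: a w already on the path would close a cycle, and distinctness stops the
  -- growth after n vertices, at which point v is a leaf.
  leaf-at-path-end : (fuel : ℕ) → ∀ v u rest → Path F (v ∷ u ∷ rest) → AllPairs _≢_ (v ∷ u ∷ rest) →
                     n < fuel + length (v ∷ u ∷ rest) → ∃₂ (Leaf F)
  leaf-at-path-end zero v u rest p vs! n<len = contradiction (distinct-length≤ vs!) (<⇒≱ n<len)
  leaf-at-path-end (suc fuel) v u rest p@(step vu _) vs! n<len
    with any? (λ w → (adj F v w ≟ᵇ true) ×-dec ¬? (w ≟ᶠ u))
  ... | no none = v , u , record { edge = vu ; unique = λ w vw → decidable-stable (w ≟ᶠ u) λ w≢u → none (w , vw , w≢u) }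
  ... | yes (w , vw , w≢u) with w ∈? rest
  ... | yes w∈rest with r₁ , r₂ , refl ← ∈-∃++ w∈rest =
    contradiction (record
      { first = v ; middle = u ; rest = r₁ ; last = w
      ; path = Path-prefix v (u ∷ r₁) p
      ; closing = adj-sym F vw
      ; distinct = AllPairs-prefix (v ∷ u ∷ r₁) vs! }) forest
  ... | no w∉rest =
    leaf-at-path-end fuel w v (u ∷ rest) (step (adj-sym F vw) p)
      ((≢-sym (adj⇒≢ F vw) ∷ w≢u ∷ ¬Any⇒All¬ rest w∉rest) ∷ vs!)
      (≤-trans n<len (≤-reflexive (sym (+-suc fuel _))))

  leaf-exists : ∀ {a b} → adj F a b ≡ true → ∃₂ (Leaf F)
  leaf-exists {a} {b} ab =
    leaf-at-path-end n b a [] (step (adj-sym F ab) (single a))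
      ((≢-sym (adj⇒≢ F ab) ∷ []) ∷ [] ∷ []) (≤-trans (n≤1+n (suc n)) (≤-reflexive (+-comm 2 n)))

module _ {n} {G : Graph n} where

  Connected-trans : ∀ {a b c} → Connected G a b → Connected G b c → Connected G a c
  Connected-trans (here _)    bc = bc
  Connected-trans (there e r) bc = there e (Connected-trans r bc)

  Connected-sym : ∀ {a b} → Connected G a b → Connected G b a
  Connected-sym (here v)        = here v
  Connected-sym {a} (there e r) = Connected-trans (Connected-sym r) (there (adj-sym G e) (here a))

  Connected-edge : ∀ {a b} → adj G a b ≡ true → Connected G a b
  Connected-edge {b = b} e = there e (here b)

-- F − x, kept on the same vertex set: x becomes isolated.
isolate : ∀ {n} → Graph n → Fin n → Graph n
isolate F x = record
  { adj    = λ u v → adj F u v ∧ (away u ∧ away v)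
  ; sym    = λ u v → cong₂ _∧_ (Graph.sym F u v) (∧-comm (away u) (away v))
  ; irrefl = λ u → cong (_∧ (away u ∧ away u)) (Graph.irrefl F u)
  }
  where
  away : _ → Bool
  away u = not (does (u ≟ᶠ x))

module Isolate {n} (F : Graph n) (x : Fin n) where

  F′ : Graph n
  F′ = isolate F x

  adj-⊆ : ∀ {u v} → adj F′ u v ≡ true → adj F u v ≡ true
  adj-⊆ {u} {v} uv with adj F u v
  ... | true = refl

  adj-≢ : ∀ {u v} → adj F′ u v ≡ true → u ≢ x
  adj-≢ {u} {v} uv refl rewrite dec-true (u ≟ᶠ u) refl | ∧-zeroʳ (adj F u v) with () ← uv

  adj-intro : ∀ {u v} → adj F u v ≡ true → u ≢ x → v ≢ x → adj F′ u v ≡ true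
  adj-intro {u} {v} uv u≢x v≢x rewrite uv | dec-false (u ≟ᶠ x) u≢x | dec-false (v ≟ᶠ x) v≢x = refl

  forest : IsForest F → IsForest F′
  forest F-forest c = F-forest record
    { first = first ; middle = middle ; rest = rest ; last = last
    ; path = Path-⊆ path ; closing = adj-⊆ closing ; distinct = distinct }
    where
    open Cycle c
    Path-⊆ : ∀ {vs} → Path F′ vs → Path F vs
    Path-⊆ (single v) = single v
    Path-⊆ (step e p) = step (adj-⊆ e) (Path-⊆ p)

  Connected-⊆ : ∀ {a b} → Connected F′ a b → Connected F a b
  Connected-⊆ (here v)    = here v
  Connected-⊆ (there e r) = there (adj-⊆ e) (Connected-⊆ r)

  NonIsolated-⊆ : ∀ {v} → NonIsolated F′ v → NonIsolated F v
  NonIsolated-⊆ (w , vw) = w , adj-⊆ vw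

  NonIsolated-≢ : ∀ {v} → NonIsolated F′ v → v ≢ x
  NonIsolated-≢ (w , vw) = adj-≢ vw

  degree-≤ : ∀ v → degree F′ v ≤ degree F v
  degree-≤ v = count-mono {p = adj F′ v} {q = adj F v} λ _ → adj-⊆

  degree-self : degree F′ x ≡ 0
  degree-self = count-false {p = adj F′ x} λ u → ¬-not λ xu → adj-≢ xu refl

module LeafDeletion {n} {F : Graph n} {x y : Fin n} (leaf : Leaf F x y) where
  open Isolate F x public

  x≢y : x ≢ y
  x≢y = adj⇒≢ F (Leaf.edge leaf)

  neighbour-of-leaf : ∀ {w} → adj F w x ≡ true → w ≡ y
  neighbour-of-leaf wx = Leaf.unique leaf _ (adj-sym F wx)

  adj-to-leaf : ∀ v → adj F v x ≡ does (v ≟ᶠ y)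
  adj-to-leaf v with v ≟ᶠ y
  ... | yes refl = adj-sym F (Leaf.edge leaf)
  ... | no v≢y   = ¬-not λ vx → v≢y (neighbour-of-leaf vx)

  degree-leaf : degree F x ≡ 1
  degree-leaf = trans (sum-cong-≗ λ w → cong bit (trans (Graph.sym F x w) (adj-to-leaf w))) (count-≟ y)

  degree-away : ∀ v → v ≢ x → degree F v ≡ degree F′ v + bit (does (v ≟ᶠ y))
  degree-away v v≢x = begin
    count (adj F v)                                ≡⟨ count-without x (adj F v) ⟩
    count (without x (adj F v)) + bit (adj F v x)  ≡⟨ cong₂ (λ c b → c + bit b) (sum-cong-≗ (cong bit ∘ same)) (adj-to-leaf v) ⟩
    degree F′ v + bit (does (v ≟ᶠ y))              ∎
    where
    open ≡-Reasoning
    same : ∀ u → without x (adj F v) u ≡ adj F′ v u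
    same u rewrite dec-false (v ≟ᶠ x) v≢x = refl

  degree-neighbour : degree F y ≡ suc (degree F′ y)
  degree-neighbour = trans (degree-away y (≢-sym x≢y))
    (trans (cong (λ b → degree F′ y + bit b) (dec-true (y ≟ᶠ y) refl)) (+-comm _ 1))

  degree-other : ∀ v → v ≢ x → v ≢ y → degree F v ≡ degree F′ v
  degree-other v v≢x v≢y = trans (degree-away v v≢x)
    (trans (cong (λ b → degree F′ v + bit b) (dec-false (v ≟ᶠ y) v≢y)) (+-identityʳ _))

  degree-sum-decreases : sum (degree F′) < sum (degree F)
  degree-sum-decreases = sum-mono-< x degree-≤ (subst₂ _<_ (sym degree-self) (sym degree-leaf) ≤-refl)

forest-induction : ∀ {n} (P : Graph n → Set) →
                   (∀ F → (∀ u v → adj F u v ≡ false) → P F) →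
                   (∀ F x y → Leaf F x y → P (isolate F x) → P F) →
                   ∀ F → IsForest F → P F
forest-induction P edgeless leaf-step F = go F (<-wellFounded (sum (degree F)))
  where
  go : ∀ F → Acc _<_ (sum (degree F)) → IsForest F → P F
  go F (acc rec) forest with any? (λ u → any? (λ v → adj F u v ≟ᵇ true))
  ... | no no-edge = edgeless F λ u v → ¬-not λ uv → no-edge (u , v , uv)
  ... | yes (a , b , ab) with x , y , leaf ← leaf-exists forest ab =
    leaf-step F x y leaf
      (go (isolate F x) (rec (LeafDeletion.degree-sum-decreases leaf)) (Isolate.forest F x forest))

branching : ∀ {n} → Graph n → ℕ
branching F = sum (λ v → degree F v ∸ 2)

branching-isolate-≤ : ∀ {n} (F : Graph n) x → branching (isolate F x) ≤ branching F
branching-isolate-≤ F x = sum-mono-≤ λ v → ∸-monoˡ-≤ 2 (Isolate.degree-≤ F x v)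

count-adj-∧ : ∀ {n} (H : Graph n) w b → count (λ z → adj H z w ∧ b) ≡ bit b * degree H w
count-adj-∧ H w true  = trans (sum-cong-≗ λ z → cong bit (trans (∧-identityʳ _) (Graph.sym H z w))) (sym (+-identityʳ _))
count-adj-∧ H w false = count-false λ z → ∧-zeroʳ (adj H z w)

bit*≤ : ∀ b d → bit b * d ≤ bit b + bit b + (d ∸ 2)
bit*≤ true  d = ≤-trans (≤-reflexive (+-identityʳ d)) (m≤n+m∸n d 2)
bit*≤ false d = z≤n

three-budgets : ∀ {a b c s d k n} → a ≤ d → b ≤ 1 → suc c ≤ s + s + k → s ≤ d → 3 * d + k < n →
                a + (b + c) < n
three-budgets {a} {b} {c} {s} {d} {k} a≤d b≤1 c<ssk s≤d bound = begin-strict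
  a + (b + c)            ≤⟨ +-mono-≤ a≤d (+-monoˡ-≤ c b≤1) ⟩
  d + suc c              ≤⟨ +-monoʳ-≤ d (≤-trans c<ssk (+-monoˡ-≤ k (+-mono-≤ s≤d s≤d))) ⟩
  d + (d + d + k)        ≡⟨ cong (λ t → d + (t + d + k)) (+-identityʳ d) ⟨
  d + (d + 0 + d + k)    ≡⟨ cong (λ t → d + (t + k)) (+-comm (d + 0) d) ⟩
  d + (d + (d + 0) + k)  ≡⟨ +-assoc d (d + (d + 0)) k ⟨
  3 * d + k              <⟨ bound ⟩
  _                      ∎
  where open ≤-Reasoning

module _ {n} (i j : Fin n) where

  transpose-matchˡ : transpose i j i ≡ j
  transpose-matchˡ rewrite dec-true (i ≟ᶠ i) refl = refl

  transpose-matchʳ : transpose i j j ≡ i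
  transpose-matchʳ with j ≟ᶠ i
  ... | yes j≡i = j≡i
  ... | no _ rewrite dec-true (j ≟ᶠ j) refl = refl

  transpose-other : ∀ {k} → k ≢ i → k ≢ j → transpose i j k ≡ k
  transpose-other {k} k≢i k≢j rewrite dec-false (k ≟ᶠ i) k≢i | dec-false (k ≟ᶠ j) k≢j = refl

  transpose-injective : Injective _≡_ _≡_ (transpose i j)
  transpose-injective {k} {l} e = begin
    k                                ≡⟨ transpose-inverse j i ⟨
    transpose j i (transpose i j k)  ≡⟨ cong (transpose j i) e ⟩
    transpose j i (transpose i j l)  ≡⟨ transpose-inverse j i ⟩
    l                                ∎
    where open ≡-Reasoning

Packs : ∀ {n} → Graph n → Graph n → (Fin n → Fin n) → Set
Packs G F f = ∀ u v → adj F u v ≡ true → adj G (f u) (f v) ≡ false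

module LeafRepacking {n} (G : Graph n) {F : Graph n} {x y : Fin n} (leaf : Leaf F x y)
                     (f : Fin n → Fin n) (f-inj : Injective _≡_ _≡_ f) where
  open LeafDeletion leaf

  repack : Packs G F′ f → (z : Fin n) → z ≢ y → adj G (f y) (f z) ≡ false →
           (∀ w → adj F′ z w ≡ true → adj G (f x) (f w) ≡ false) → Pack G F
  repack f-packs z z≢y fyz z-free = g , transpose-injective x z ∘ f-inj , g-packs
    where
    g : Fin n → Fin n
    g = f ∘ transpose x z

    g-other : ∀ {v} → v ≢ x → v ≢ z → g v ≡ f v
    g-other v≢x v≢z = cong f (transpose-other x z v≢x v≢z)

    packs-at-end : ∀ u v → adj F u v ≡ true → u ≡ x ⊎ (u ≢ x × u ≡ z) → adj G (g u) (g v) ≡ false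
    packs-at-end u v uv (inj₁ refl) with refl ← Leaf.unique leaf v uv =
      subst₂ (λ a b → adj G a b ≡ false) (sym (cong f (transpose-matchˡ x z)))
        (sym (g-other (≢-sym x≢y) (≢-sym z≢y))) (nonadj-sym G fyz)
    packs-at-end u v uv (inj₂ (u≢x , u≡z)) =
      subst₂ (λ a b → adj G a b ≡ false) (sym gu≡fx) (sym (g-other v≢x v≢z)) (z-free v (adj-intro zv z≢x v≢x))
      where
      zv : adj F z v ≡ true
      zv = subst (λ t → adj F t v ≡ true) u≡z uv
      z≢x : z ≢ x
      z≢x = u≢x ∘ trans u≡z
      v≢x : v ≢ x
      v≢x refl = z≢y (neighbour-of-leaf zv)
      v≢z : v ≢ z
      v≢z = ≢-sym (adj⇒≢ F zv)
      gu≡fx : g u ≡ f x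
      gu≡fx = cong f (trans (cong (transpose x z) u≡z) (transpose-matchʳ x z))

    g-packs : Packs G F g
    g-packs u v uv = by-cases (u ≟ᶠ x) (u ≟ᶠ z) (v ≟ᶠ x) (v ≟ᶠ z)
      where
      by-cases : Dec (u ≡ x) → Dec (u ≡ z) → Dec (v ≡ x) → Dec (v ≡ z) → adj G (g u) (g v) ≡ false
      by-cases (yes u≡x) _         _         _         = packs-at-end u v uv (inj₁ u≡x)
      by-cases (no u≢x)  (yes u≡z) _         _         = packs-at-end u v uv (inj₂ (u≢x , u≡z))
      by-cases (no _)    (no _)    (yes v≡x) _         = nonadj-sym G (packs-at-end v u (adj-sym F uv) (inj₁ v≡x))
      by-cases (no _)    (no _)    (no v≢x)  (yes v≡z) = nonadj-sym G (packs-at-end v u (adj-sym F uv) (inj₂ (v≢x , v≡z)))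
      by-cases (no u≢x)  (no u≢z)  (no v≢x)  (no v≢z)  =
        subst₂ (λ a b → adj G a b ≡ false) (sym (g-other u≢x u≢z)) (sym (g-other v≢x v≢z))
          (f-packs u v (adj-intro uv u≢x v≢x))

  exchange-vertex : adj G (f x) (f y) ≡ true → 3 * Δ G + branching F < n →
                    ∃[ z ] z ≢ y × adj G (f y) (f z) ≡ false × (∀ w → adj F′ z w ≡ true → adj G (f x) (f w) ≡ false)
  exchange-vertex fxy bound = z , z≢y , fyz , z-free
    where
    S : Fin n → Bool
    S w = adj G (f x) (f w)

    near-S : Fin n → Bool
    near-S z = does (any? λ w → (adj F′ z w ∧ S w) ≟ᵇ true)

    excluded : Fin n → Bool
    excluded z = adj G (f y) (f z) ∨ (does (z ≟ᶠ y) ∨ near-S z)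

    count-image : ∀ a → count (adj G (f a) ∘ f) ≤ Δ G
    count-image a = ≤-trans (count-∘-injective (adj G (f a)) f f-inj) (degree≤Δ G (f a))

    count-near-S : suc (count near-S) ≤ count S + count S + branching F
    count-near-S = begin
      suc (count near-S)                                     ≤⟨ s≤s (union-bound (λ z w → adj F′ z w ∧ S w)) ⟩
      suc (∑[ w < n ] count (λ z → adj F′ z w ∧ S w))        ≡⟨ cong suc (sum-cong-≗ λ w → count-adj-∧ F′ w (S w)) ⟩
      suc (∑[ w < n ] (bit (S w) * degree F′ w))             ≤⟨ sum-mono-< y (λ w → *-monoʳ-≤ (bit (S w)) (degree-≤ w)) y-lost-x ⟩
      ∑[ w < n ] (bit (S w) * degree F w)                    ≤⟨ sum-mono-≤ (λ w → bit*≤ (S w) (degree F w)) ⟩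
      ∑[ w < n ] (bit (S w) + bit (S w) + (degree F w ∸ 2))  ≡⟨ ∑-distrib-+ (λ w → bit (S w) + bit (S w)) _ ⟩
      ∑[ w < n ] (bit (S w) + bit (S w)) + branching F       ≡⟨ cong (_+ branching F) (∑-distrib-+ (bit ∘ S) (bit ∘ S)) ⟩
      count S + count S + branching F                        ∎
      where
      open ≤-Reasoning
      y-lost-x : bit (S y) * degree F′ y < bit (S y) * degree F y
      y-lost-x rewrite fxy | degree-neighbour = ≤-refl

    count-excluded : count excluded < n
    count-excluded =
      ≤-<-trans (≤-trans (count-∨ (adj G (f y) ∘ f) _) (+-monoʳ-≤ _ (count-∨ (λ z → does (z ≟ᶠ y)) near-S)))
        (three-budgets (count-image y) (≤-reflexive (count-≟ y)) count-near-S (count-image x) bound)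

    z : Fin n
    z = proj₁ (count<n⇒∃false excluded count-excluded)

    z-allowed : excluded z ≡ false
    z-allowed = proj₂ (count<n⇒∃false excluded count-excluded)

    fyz : adj G (f y) (f z) ≡ false
    fyz = ∨-conicalˡ _ _ z-allowed

    rest-allowed : (does (z ≟ᶠ y) ∨ near-S z) ≡ false
    rest-allowed = ∨-conicalʳ (adj G (f y) (f z)) _ z-allowed

    z≢y : z ≢ y
    z≢y z≡y with () ← trans (sym (∨-conicalˡ (does (z ≟ᶠ y)) (near-S z) rest-allowed)) (dec-true (z ≟ᶠ y) z≡y)

    z-free : ∀ w → adj F′ z w ≡ true → adj G (f x) (f w) ≡ false
    z-free w zw = ¬-not λ Sw → contradiction
      (trans (sym (dec-true (any? _) (w , near Sw))) (∨-conicalʳ (does (z ≟ᶠ y)) _ rest-allowed)) λ ()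
      where
      near : S w ≡ true → (adj F′ z w ∧ S w) ≡ true
      near Sw rewrite zw | Sw = refl

  pack-leaf : Packs G F′ f → 3 * Δ G + branching F < n → Pack G F
  pack-leaf f-packs bound with adj G (f x) (f y) in fxy
  -- z = x: the transposition is the identity.
  ... | false = repack f-packs x x≢y (nonadj-sym G fxy) λ w xw → contradiction refl (adj-≢ xw)
  ... | true with z , z≢y , fyz , z-free ← exchange-vertex fxy bound = repack f-packs z z≢y fyz z-free

pack-forest : ∀ {n} (G F : Graph n) → IsForest F → 3 * Δ G + branching F < n → Pack G F
pack-forest {n} G = forest-induction (λ F → 3 * Δ G + branching F < n → Pack G F) edgeless leaf-step
  where
  edgeless : ∀ F → (∀ u v → adj F u v ≡ false) → 3 * Δ G + branching F < n → Pack G F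
  edgeless F no-edge _ = id , id , λ u v uv → contradiction (trans (sym uv) (no-edge u v)) λ ()

  leaf-step : ∀ F x y → Leaf F x y → (3 * Δ G + branching (isolate F x) < n → Pack G (isolate F x)) →
              3 * Δ G + branching F < n → Pack G F
  leaf-step F x y leaf pack′ bound
    with f , f-inj , f-packs ← pack′ (≤-<-trans (+-monoʳ-≤ (3 * Δ G) (branching-isolate-≤ F x)) bound) =
    LeafRepacking.pack-leaf G leaf f f-inj f-packs bound

module LeafComponents {n} {F : Graph n} {x y : Fin n} (leaf : Leaf F x y) where
  open LeafDeletion leaf

  -- A walk can visit the leaf x only as y, x, y; cutting out that detour avoids x.
  Connected-lift : ∀ {a b} → Connected F a b → a ≢ x → b ≢ x → Connected F′ a b
  Connected-lift (here v) _ _ = here v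
  Connected-lift (there {w = w} aw r) a≢x b≢x with w ≟ᶠ x
  ... | no w≢x = there (adj-intro aw a≢x w≢x) (Connected-lift r w≢x b≢x)
  Connected-lift (there aw (here _))          a≢x b≢x | yes refl = contradiction refl b≢x
  Connected-lift (there aw (there xw′ r))     a≢x b≢x | yes refl =
    subst (λ t → Connected F′ t _) (trans (Leaf.unique leaf _ xw′) (sym (neighbour-of-leaf aw)))
      (Connected-lift r (λ w′≡x → x≢y (trans (sym w′≡x) (Leaf.unique leaf _ xw′))) b≢x)

  module _ (y-kept : NonIsolated F′ y) where

    NonIsolated-lift : ∀ {u} → u ≢ x → NonIsolated F u → NonIsolated F′ u
    NonIsolated-lift {u} u≢x (w , uw) with w ≟ᶠ x
    ... | yes refl = subst (NonIsolated F′) (sym (neighbour-of-leaf uw)) y-kept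
    ... | no w≢x   = w , adj-intro uw u≢x w≢x

    delegate : ∀ v → NonIsolated F v → Σ (Fin n) λ s → s ≢ x × Connected F v s × NonIsolated F′ s
    delegate v v-ni with v ≟ᶠ x
    ... | yes refl = y , ≢-sym x≢y , Connected-edge (Leaf.edge leaf) , y-kept
    ... | no v≢x   = v , v≢x , here v , NonIsolated-lift v≢x v-ni

    components-kept : ∀ {c} → NontrivialComponents F c → NontrivialComponents F′ c
    components-kept (rep , rep-ni , rep-apart , rep-cover) = rep′ , rep′-ni , rep′-apart , rep′-cover
      where
      rep′ : _ → Fin n
      rep′ i = proj₁ (delegate (rep i) (rep-ni i))
      rep′≢x : ∀ i → rep′ i ≢ x
      rep′≢x i = proj₁ (proj₂ (delegate (rep i) (rep-ni i)))
      rep~rep′ : ∀ i → Connected F (rep i) (rep′ i)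
      rep~rep′ i = proj₁ (proj₂ (proj₂ (delegate (rep i) (rep-ni i))))
      rep′-ni : ∀ i → NonIsolated F′ (rep′ i)
      rep′-ni i = proj₂ (proj₂ (proj₂ (delegate (rep i) (rep-ni i))))
      rep′-apart : ∀ i j → Connected F′ (rep′ i) (rep′ j) → i ≡ j
      rep′-apart i j ij = rep-apart i j
        (Connected-trans (rep~rep′ i) (Connected-trans (Connected-⊆ ij) (Connected-sym (rep~rep′ j))))
      rep′-cover : ∀ v → NonIsolated F′ v → ∃[ i ] Connected F′ v (rep′ i)
      rep′-cover v v-ni with i , vi ← rep-cover v (NonIsolated-⊆ v-ni) =
        i , Connected-lift (Connected-trans vi (rep~rep′ i)) (NonIsolated-≢ v-ni) (rep′≢x i)

  module _ (y-lost : ¬ NonIsolated F′ y) where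

    y-neighbour : ∀ {w} → adj F y w ≡ true → w ≡ x
    y-neighbour {w} yw = decidable-stable (w ≟ᶠ x) λ w≢x → y-lost (w , adj-intro yw (≢-sym x≢y) w≢x)

    InEdge : Fin n → Set
    InEdge v = v ≡ x ⊎ v ≡ y

    InEdge-closed : ∀ {a b} → Connected F a b → InEdge a → InEdge b
    InEdge-closed (here _)     a∈ = a∈
    InEdge-closed (there aw r) (inj₁ refl) = InEdge-closed r (inj₂ (Leaf.unique leaf _ aw))
    InEdge-closed (there aw r) (inj₂ refl) = InEdge-closed r (inj₁ (y-neighbour aw))

    InEdge⇒connected : ∀ {a} → InEdge a → Connected F a x
    InEdge⇒connected (inj₁ refl) = here _
    InEdge⇒connected (inj₂ refl) = Connected-sym (Connected-edge (Leaf.edge leaf))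

    InEdge⇒isolated : ∀ {v} → InEdge v → ¬ NonIsolated F′ v
    InEdge⇒isolated (inj₁ refl) v-ni = NonIsolated-≢ v-ni refl
    InEdge⇒isolated (inj₂ refl)      = y-lost

    -- The component {x, y} has a representative k, which is dropped.
    components-lost : ∀ {c} → NontrivialComponents F (suc c) → NontrivialComponents F′ c
    components-lost (rep , rep-ni , rep-apart , rep-cover) = rep′ , rep′-ni , rep′-apart , rep′-cover
      where
      k : Fin _
      k = proj₁ (rep-cover x (y , Leaf.edge leaf))
      x~k : Connected F x (rep k)
      x~k = proj₂ (rep-cover x (y , Leaf.edge leaf))
      outside : ∀ j → j ≢ k → ¬ InEdge (rep j)
      outside j j≢k j∈ = j≢k (rep-apart j k (Connected-trans (InEdge⇒connected j∈) x~k))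
      rep′ : _ → Fin n
      rep′ i = rep (punchIn k i)
      rep′-outside : ∀ i → ¬ InEdge (rep′ i)
      rep′-outside i = outside (punchIn k i) (punchInᵢ≢i k i)
      rep′-ni : ∀ i → NonIsolated F′ (rep′ i)
      rep′-ni i with w , rw ← rep-ni (punchIn k i) with w ≟ᶠ x
      ... | yes refl = contradiction (inj₂ (neighbour-of-leaf rw)) (rep′-outside i)
      ... | no w≢x   = w , adj-intro rw (rep′-outside i ∘ inj₁) w≢x
      rep′-apart : ∀ i j → Connected F′ (rep′ i) (rep′ j) → i ≡ j
      rep′-apart i j ij = punchIn-injective k i j (rep-apart _ _ (Connected-⊆ ij))
      rep′-cover : ∀ v → NonIsolated F′ v → ∃[ i ] Connected F′ v (rep′ i)
      rep′-cover v v-ni with j , vj ← rep-cover v (NonIsolated-⊆ v-ni) with k ≟ᶠ j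
      ... | yes refl = contradiction v-ni
                         (InEdge⇒isolated (InEdge-closed (Connected-trans x~k (Connected-sym vj)) (inj₁ refl)))
      ... | no k≢j   = punchOut k≢j ,
        subst (Connected F′ v ∘ rep) (sym (punchIn-punchOut k≢j))
          (Connected-lift vj (NonIsolated-≢ v-ni) (outside j (k≢j ∘ sym) ∘ inj₁))

isOne : ℕ → ℕ
isOne t = bit (does (t ℕ.≟ 1))

leafCount : ∀ {n} → Graph n → ℕ
leafCount F = sum (isOne ∘ degree F)

leaves≡leafCount : ∀ {n} (F : Graph n) → leaves F ≡ leafCount F
leaves≡leafCount F = trans (length-filter-tabulate (λ v → deg F v ℕ.≟ 1) id)
                           (sum-cong-≗ λ v → cong isOne (deg≡degree F v))

exchange-bound : ∀ {K K′ L L′ u u′ v v′ C C′} → K + u ≡ K′ + u′ → L + v ≡ L′ + v′ →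
                 K′ + C′ ≤ L′ → u′ + v + C ≤ u + v′ + C′ → K + C ≤ L
exchange-bound {K} {K′} {L} {L′} {u} {u′} {v} {v′} {C} {C′} eK eL bound′ side =
  +-cancelˡ-≤ (u + v) (K + C) L (begin
    u + v + (K + C)     ≡⟨ shuffle₁ u v K C ⟩
    K + u + (v + C)     ≡⟨ cong (_+ (v + C)) eK ⟩
    K′ + u′ + (v + C)   ≡⟨ shuffle₂ K′ u′ v C ⟩
    K′ + (u′ + v + C)   ≤⟨ +-monoʳ-≤ K′ side ⟩
    K′ + (u + v′ + C′)  ≡⟨ shuffle₃ K′ u v′ C′ ⟩
    K′ + C′ + (u + v′)  ≤⟨ +-monoˡ-≤ (u + v′) bound′ ⟩
    L′ + (u + v′)       ≡⟨ shuffle₄ L′ u v′ ⟩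
    L′ + v′ + u         ≡⟨ cong (_+ u) eL ⟨
    L + v + u           ≡⟨ shuffle₅ L v u ⟩
    u + v + L           ∎)
  where
  open ≤-Reasoning
  shuffle₁ : ∀ u v K C → u + v + (K + C) ≡ K + u + (v + C)
  shuffle₁ = solve-∀
  shuffle₂ : ∀ K u v C → K + u + (v + C) ≡ K + (u + v + C)
  shuffle₂ = solve-∀
  shuffle₃ : ∀ K u v C → K + (u + v + C) ≡ K + C + (u + v)
  shuffle₃ = solve-∀
  shuffle₄ : ∀ L u v → L + (u + v) ≡ L + v + u
  shuffle₄ = solve-∀
  shuffle₅ : ∀ L v u → L + v + u ≡ u + v + L
  shuffle₅ = solve-∀

-- Local changes in (deg ∸ 2) and in the number of degree-one vertices when a leaf hangs off a
-- vertex of remaining degree d; d = 0 is exactly when a whole component disappears.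
kept-weights : ∀ d → 0 < d → (suc d ∸ 2) + isOne d ≤ (d ∸ 2) + (1 + isOne (suc d))
kept-weights (suc zero)    _ = ≤-refl
kept-weights (suc (suc e)) _ = ≤-reflexive (trans (+-identityʳ _) (+-comm 1 e))

lost-weights : ∀ d → d ≡ 0 → ∀ c → (suc d ∸ 2) + isOne d + 2 * suc c ≤ (d ∸ 2) + (1 + isOne (suc d)) + 2 * c
lost-weights .0 refl c = ≤-reflexive (*-suc 2 c)

module LeafCounting {n} {F : Graph n} {x y : Fin n} (leaf : Leaf F x y) where
  open LeafDeletion leaf
  open LeafComponents leaf

  weight-exchange : ∀ (φ : ℕ → ℕ) →
    sum (φ ∘ degree F) + (φ 0 + φ (degree F′ y)) ≡ sum (φ ∘ degree F′) + (φ 1 + φ (suc (degree F′ y)))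
  weight-exchange φ = begin
    sum (φ ∘ degree F) + (φ 0 + φ (degree F′ y))
      ≡⟨ cong (λ t → sum (φ ∘ degree F) + (φ t + φ (degree F′ y))) degree-self ⟨
    sum (φ ∘ degree F) + (φ (degree F′ x) + φ (degree F′ y))
      ≡⟨ sum-exchange₂ {h = φ ∘ degree F} {k = φ ∘ degree F′} x≢y (λ v v≢x v≢y → cong φ (degree-other v v≢x v≢y)) ⟩
    sum (φ ∘ degree F′) + (φ (degree F x) + φ (degree F y))
      ≡⟨ cong₂ (λ s t → sum (φ ∘ degree F′) + (φ s + φ t)) degree-leaf degree-neighbour ⟩
    sum (φ ∘ degree F′) + (φ 1 + φ (suc (degree F′ y)))
      ∎
    where open ≡-Reasoning

  bound-step : ∀ {c c′} → branching F′ + 2 * c′ ≤ leafCount F′ →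
               (suc (degree F′ y) ∸ 2) + isOne (degree F′ y) + 2 * c
                 ≤ (degree F′ y ∸ 2) + (1 + isOne (suc (degree F′ y))) + 2 * c′ →
               branching F + 2 * c ≤ leafCount F
  bound-step = exchange-at (degree F′ y) (weight-exchange (_∸ 2)) (weight-exchange isOne)
    where
    exchange-at : ∀ d {K K′ L L′ C C′} → K + (0 + (d ∸ 2)) ≡ K′ + (0 + (suc d ∸ 2)) →
                  L + (0 + isOne d) ≡ L′ + (1 + isOne (suc d)) → K′ + C′ ≤ L′ →
                  (suc d ∸ 2) + isOne d + C ≤ (d ∸ 2) + (1 + isOne (suc d)) + C′ → K + C ≤ L
    exchange-at d {K} {K′} {L} {L′} {C} {C′} =
      exchange-bound {K} {K′} {L} {L′} {0 + (d ∸ 2)} {0 + (suc d ∸ 2)} {0 + isOne d} {1 + isOne (suc d)} {C} {C′}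

  leaf-bound-step : (∀ c → NontrivialComponents F′ c → branching F′ + 2 * c ≤ leafCount F′) →
                    ∀ c → NontrivialComponents F c → branching F + 2 * c ≤ leafCount F
  leaf-bound-step bound′ c comps with any? (λ w → adj F′ y w ≟ᵇ true)
  ... | yes y-kept@(w , yw) =
    bound-step {c = c} {c′ = c} (bound′ c (components-kept y-kept comps))
      (+-monoˡ-≤ (2 * c) (kept-weights (degree F′ y) (count-true {p = adj F′ y} w yw)))
  ... | no y-lost with c | comps
  ...   | zero   | (_ , _ , _ , cover) with () ← proj₁ (cover x (y , Leaf.edge leaf))
  ...   | suc c′ | comps =
    bound-step {c = suc c′} {c′ = c′} (bound′ c′ (components-lost y-lost comps))
      (lost-weights (degree F′ y) (count-false {p = adj F′ y} λ w → ¬-not λ yw → y-lost (w , yw)) c′)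

leaf-bound : ∀ {n} (F : Graph n) → IsForest F → ∀ c → NontrivialComponents F c → branching F + 2 * c ≤ leafCount F
leaf-bound = forest-induction (λ F → ∀ c → NontrivialComponents F c → branching F + 2 * c ≤ leafCount F)
                   edgeless (λ F x y leaf → LeafCounting.leaf-bound-step leaf)
  where
  edgeless : ∀ F → (∀ u v → adj F u v ≡ false) → ∀ c → NontrivialComponents F c → branching F + 2 * c ≤ leafCount F
  edgeless F no-edge zero _ =
    ≤-trans (≤-reflexive (trans (+-identityʳ _) (sum-zero λ v → cong (_∸ 2) (count-false (no-edge v))))) z≤n
  edgeless F no-edge (suc c) (rep , rep-ni , _) with w , rw ← rep-ni zero with () ← trans (sym rw) (no-edge (rep zero) w)

theorem8 : (n : ℕ) (F G : Graph n) → IsForest F → (c : ℕ) → NontrivialComponents F c →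
             3 * Δ G + leaves F < n + 2 * c → Pack G F
theorem8 n F G forest c comps bound =
  pack-forest G F forest (+-cancelʳ-< (2 * c) (3 * Δ G + branching F) n (begin-strict
    3 * Δ G + branching F + 2 * c    ≡⟨ +-assoc (3 * Δ G) (branching F) (2 * c) ⟩
    3 * Δ G + (branching F + 2 * c)  ≤⟨ +-monoʳ-≤ (3 * Δ G) (leaf-bound F forest c comps) ⟩
    3 * Δ G + leafCount F            ≡⟨ cong (3 * Δ G +_) (leaves≡leafCount F) ⟨
    3 * Δ G + leaves F               <⟨ bound ⟩
    n + 2 * c                        ∎))
  where open ≤-Reasoning
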